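{- Let $\mathcal{D}_S=(A,X_1,\ldots,X_n,U,P)$ be a stochastic decision problem with $A\neq\emptyset$ and $P(s)>0$ for every $s\in S$, and let $I\subseteq\{1,\ldots,n\}$. Then $I$ is (statically) sufficient if and only if $I$ is stochastically sufficient.
   Context: A stochastic decision problem is a tuple $(A,X_1,\ldots,X_n,U,P)$ with $A$ a finite set of actions, $X_i$ finite sets, $S=X_1\times\cdots\times X_n$, $U:A\times S\to\mathbb{Q}$, $P$ a probability distribution on $S$. $s_I$ is the restriction of $s$ to coordinates in $I$. $\mathrm{Opt}(s)=\arg\max_{a\in A}U(a,s)$. $I$ is (statically) sufficient if $s_I=s'_I$ implies $\mathrm{Opt}(s)=\mathrm{Opt}(s')$. For a value $\alpha$ of the $I$-coordinates with $P(S_I=\alpha)>0$, $\mathrm{Opt}^{\mathrm{stoch}}_I(\alpha)=\arg\max_{a\in A}\mathbb{E}[U(a,S)\mid S_I=\alpha]$ with $S\sim P$. $I$ is stochastically sufficient if $\mathrm{Opt}^{\mathrm{stoch}}_I(s_I)=\mathrm{Opt}(s)$ for every $s\in S$.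
   Formalization: The probability distribution P on S takes only rational values. -}

module Defs where

open import Data.Nat using (ℕ; zero; suc)
open import Data.Fin using (Fin; zero; suc)
open import Data.Fin.Properties using (_≟_)
open import Data.Fin.Subset using (Subset; _∈_)
open import Data.Fin.Subset.Properties using (_∈?_)
open import Data.Bool using (Bool; true; false; _∧_)
open import Data.List using (List; []; _∷_; map; concatMap; foldr; filterᵇ; allFin)
open import Data.Rational using (ℚ; 0ℚ; _+_; _*_; _÷_; _≤_; _<_; ≢-nonZero)
open import Relation.Nullary using (yes; no)
open import Relation.Nullary.Decidable using (⌊_⌋)
open import Relation.Binary.PropositionalEquality using (_≡_)
open import Function.Bundles using (_⇔_)

-- A stochastic decision problem (A, X_1, …, X_n, U, P).
-- A = Fin m, X_i = Fin (k i); S = X_1 × ⋯ × X_n is the dependent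
-- function type (i : Fin n) → Fin (k i).

State : (n : ℕ) → (Fin n → ℕ) → Set
State n k = (i : Fin n) → Fin (k i)

allStates : (n : ℕ) (k : Fin n → ℕ) → List (State n k)
allStates zero    k = (λ ()) ∷ []
allStates (suc n) k =
  concatMap (λ x → map (λ r → cons x r) (allStates n (λ i → k (suc i))))
            (allFin (k zero))
  where
    cons : Fin (k zero) → State n (λ i → k (suc i)) → State (suc n) k
    cons x r zero    = x
    cons x r (suc i) = r i

sumℚ : List ℚ → ℚ
sumℚ = foldr _+_ 0ℚ

IValue : (n : ℕ) → (Fin n → ℕ) → Subset n → Set
IValue n k I = (i : Fin n) → i ∈ I → Fin (k i)

restrict : ∀ {n k} (I : Subset n) → State n k → IValue n k I
restrict I s i _ = s i

agreesᵇ : ∀ {n k} (I : Subset n) → IValue n k I → State n k → Bool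
agreesᵇ {n} I α s = foldr (λ i b → test i ∧ b) true (allFin n)
  where
    test : Fin n → Bool
    test i with i ∈? I
    ... | yes p = ⌊ s i ≟ α i p ⌋
    ... | no  _ = true

Opt : ∀ {m n k} → (Fin m → State n k → ℚ) → State n k → Fin m → Set
Opt U s a = ∀ b → U b s ≤ U a s

SameSet : ∀ {m} → (Fin m → Set) → (Fin m → Set) → Set
SameSet {m} X Y = (a : Fin m) → X a ⇔ Y a

Sufficient : ∀ {m n k} → (Fin m → State n k → ℚ) → Subset n → Set
Sufficient U I =
  ∀ s s' → ((i : _) → i ∈ I → s i ≡ s' i) → SameSet (Opt U s) (Opt U s')

probEvent : ∀ {n k} → (State n k → ℚ) → (I : Subset n) → IValue n k I → ℚ
probEvent {n} {k} P I α = sumℚ (map P (filterᵇ (agreesᵇ I α) (allStates n k)))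

-- E[U(a,S) | S_I = α] = Σ_{s : s_I = α} P(s) U(a,s) / P(S_I = α).
-- (Defined as 0 when P(S_I = α) = 0; that case never arises here.)
condExp : ∀ {m n k} → (Fin m → State n k → ℚ) → (State n k → ℚ) →
          (I : Subset n) → IValue n k I → Fin m → ℚ
condExp {n = n} {k = k} U P I α a with Data.Rational._≟_ (probEvent P I α) 0ℚ
... | yes _  = 0ℚ
... | no ne  = _÷_ (sumℚ (map (λ s → P s * U a s) (filterᵇ (agreesᵇ I α) (allStates n k))))
                   (probEvent P I α) {{≢-nonZero ne}}

OptStoch : ∀ {m n k} → (Fin m → State n k → ℚ) → (State n k → ℚ) →
           (I : Subset n) → IValue n k I → Fin m → Set
OptStoch U P I α a = ∀ b → condExp U P I α b ≤ condExp U P I α a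

StochSufficient : ∀ {m n k} → (Fin m → State n k → ℚ) → (State n k → ℚ) →
                  Subset n → Set
StochSufficient U P I = ∀ s → SameSet (OptStoch U P I (restrict I s)) (Opt U s)

IsFullSupportDist : ∀ {n k} → (State n k → ℚ) → Set
IsFullSupportDist {n} {k} P = ((s : State n k) → 0ℚ < P s) × (sumℚ (map P (allStates n k)) ≡ Data.Rational.1ℚ)
  where open import Data.Product using (_×_)

-- Conditioning on S_I = α divides every expected utility by the same positive number P(S_I = α),
-- so Opt^stoch_I(α) is the argmax of the weighted utility Σ_{t_I = α} P(t) U(a,t) over the fibre
-- of α. If I is sufficient, all states in the fibre of s share the optimal actions of s; with
-- positive weights these maximise the weighted sum, while any other action is beaten at every
-- state of the fibre by an optimum of s, which exists because A ≠ ∅. Conversely, stochastic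
-- sufficiency makes Opt(s) = Opt^stoch_I(s_I) depend on the fibre of s_I alone.
module Submission where

open import Defs
open import Data.Bool using (Bool; true; T; _∧_)
open import Data.Bool.Properties using (T?; T-∧)
open import Data.Empty using (⊥-elim)
open import Data.Fin using (Fin; zero; suc)
open import Data.Fin.Subset using (Subset; _∈_)
open import Data.Fin.Subset.Properties using (_∈?_)
open import Data.List using (List; []; _∷_; map; foldr; filterᵇ; allFin)
open import Data.List.Membership.Propositional using (lose) renaming (_∈_ to _∈ₗ_)
open import Data.List.Membership.Propositional.Properties
  using (∈-allFin; ∈-filter⁺; ∈-filter⁻; ∈-map⁺; ∈-concatMap⁺)
open import Data.List.Properties using (filter-≐)
open import Data.List.Relation.Unary.All as All using (All; []; _∷_)
open import Data.List.Relation.Unary.All.Properties using (¬All⇒Any¬)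
open import Data.List.Relation.Unary.Any as Any using (here; there)
open import Data.Nat using (ℕ; zero; suc; _≤_)
open import Data.Product using (∃; _×_; _,_; proj₁; proj₂)
open import Data.Rational using (ℚ; 0ℚ; _+_; _*_; _÷_; 1/_; NonZero; Positive; NonNegative; positive)
  renaming (_≤_ to _≤ℚ_; _<_ to _<ℚ_)
import Data.Rational.Properties as ℚ
open import Data.Vec.Properties.WithK using ([]=-irrelevant)
open import Function using (_∘_)
open import Function.Bundles using (_⇔_; mk⇔; Equivalence)
import Function.Properties.Equivalence as ⇔
open import Level using (0ℓ)
open import Relation.Binary.Bundles using (DecTotalOrder)
open import Relation.Binary.PropositionalEquality using (_≡_; refl; sym; trans; cong; subst)
open import Relation.Nullary using (yes; no)
open import Relation.Nullary.Decidable using (toWitness; fromWitness)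
open import Data.List.Extrema (DecTotalOrder.totalOrder ℚ.≤-decTotalOrder) using (argmax; f[xs]≤f[argmax])

open Equivalence using (to; from)

sumℚ-mono-≤ : ∀ {A : Set} {f g : A → ℚ} xs → (∀ {x} → x ∈ₗ xs → f x ≤ℚ g x) →
              sumℚ (map f xs) ≤ℚ sumℚ (map g xs)
sumℚ-mono-≤ []       f≤g = ℚ.≤-refl
sumℚ-mono-≤ (x ∷ xs) f≤g = ℚ.+-mono-≤ (f≤g (here refl)) (sumℚ-mono-≤ xs (f≤g ∘ there))

sumℚ-mono-< : ∀ {A : Set} {f g : A → ℚ} {x₀} xs → (∀ {x} → x ∈ₗ xs → f x ≤ℚ g x) →
              x₀ ∈ₗ xs → f x₀ <ℚ g x₀ → sumℚ (map f xs) <ℚ sumℚ (map g xs)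
sumℚ-mono-< (x ∷ xs) f≤g (here refl)   fx<gx =
  ℚ.+-mono-<-≤ fx<gx (sumℚ-mono-≤ xs (f≤g ∘ there))
sumℚ-mono-< (x ∷ xs) f≤g (there x₀∈xs) fx<gx =
  ℚ.+-mono-≤-< (f≤g (here refl)) (sumℚ-mono-< xs (f≤g ∘ there) x₀∈xs fx<gx)

sumℚ-zeros : ∀ {A : Set} (xs : List A) → sumℚ (map (λ _ → 0ℚ) xs) ≡ 0ℚ
sumℚ-zeros []       = refl
sumℚ-zeros (x ∷ xs) = cong (0ℚ +_) (sumℚ-zeros xs)

sumℚ-pos : ∀ {A : Set} {f : A → ℚ} {x₀} xs → (∀ {x} → x ∈ₗ xs → 0ℚ <ℚ f x) →
           x₀ ∈ₗ xs → 0ℚ <ℚ sumℚ (map f xs)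
sumℚ-pos {f = f} xs f>0 x₀∈xs =
  subst (_<ℚ sumℚ (map f xs)) (sumℚ-zeros xs) (sumℚ-mono-< xs (ℚ.<⇒≤ ∘ f>0) x₀∈xs (f>0 x₀∈xs))

÷-monoˡ-≤⇔ : ∀ {x y} z .{{_ : Positive z}} →
             _÷_ x z {{ℚ.pos⇒nonZero z}} ≤ℚ _÷_ y z {{ℚ.pos⇒nonZero z}} ⇔ x ≤ℚ y
÷-monoˡ-≤⇔ z = mk⇔ (ℚ.*-cancelʳ-≤-pos (1/ z)) (ℚ.*-monoʳ-≤-nonNeg (1/ z))
  where
  instance
    z≢0 : NonZero z
    z≢0 = ℚ.pos⇒nonZero z
    1/z>0 : Positive (1/ z)
    1/z>0 = ℚ.1/pos⇒pos z
    1/z≥0 : NonNegative (1/ z)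
    1/z≥0 = ℚ.pos⇒nonNeg (1/ z)

T-foldr-∧⇔All : ∀ {A : Set} (t : A → Bool) xs →
                T (foldr (λ x b → t x ∧ b) true xs) ⇔ All (T ∘ t) xs
T-foldr-∧⇔All t []       = mk⇔ (λ _ → []) (λ _ → _)
T-foldr-∧⇔All t (x ∷ xs) = mk⇔
  (λ h → let tx , rest = to T-∧ h in tx ∷ to (T-foldr-∧⇔All t xs) rest)
  (λ { (tx ∷ rest) → from T-∧ (tx , from (T-foldr-∧⇔All t xs) rest) })

module _ {n : ℕ} {k : Fin n → ℕ} where

  Opt-nonempty : ∀ {m} (U : Fin (suc m) → State n k → ℚ) s → ∃ (Opt U s)
  Opt-nonempty U s = argmax (λ a → U a s) zero (allFin _) ,
                     λ b → All.lookup (f[xs]≤f[argmax] {f = λ a → U a s} zero (allFin _)) (∈-allFin b)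

  Opt⇔≥-optimum : ∀ {m} (U : Fin m → State n k → ℚ) {s a c} →
                  Opt U s a → Opt U s c ⇔ U a s ≤ℚ U c s
  Opt⇔≥-optimum U a-opt = mk⇔ (λ c-opt → c-opt _) (λ a≤c b → ℚ.≤-trans (a-opt b) a≤c)

  -- The coordinate test of agreesᵇ is local to Defs, so its cases are reached by abstracting i ∈? I.
  agreesᵇ⇔ : (I : Subset n) (α : IValue n k I) (s : State n k) →
             T (agreesᵇ I α s) ⇔ (∀ i (i∈I : i ∈ I) → s i ≡ α i i∈I)
  agreesᵇ⇔ I α s = mk⇔ sound complete
    where
    sound : T (agreesᵇ I α s) → ∀ i (i∈I : i ∈ I) → s i ≡ α i i∈I
    sound agree i i∈I
      with i ∈? I | All.lookup (to (T-foldr-∧⇔All _ (allFin n)) agree) (∈-allFin i)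
    ... | yes i∈I′ | sᵢ≟αᵢ = trans (toWitness sᵢ≟αᵢ) (cong (α i) ([]=-irrelevant i∈I′ i∈I))
    ... | no  i∉I  | _     = ⊥-elim (i∉I i∈I)

    complete : (∀ i (i∈I : i ∈ I) → s i ≡ α i i∈I) → T (agreesᵇ I α s)
    complete agree with T? (agreesᵇ I α s)
    ... | yes agreeᵇ = agreeᵇ
    ... | no ¬agreeᵇ
      with Any.satisfied (¬All⇒Any¬ (T? ∘ _) (allFin n)
                                    (¬agreeᵇ ∘ from (T-foldr-∧⇔All _ (allFin n))))
    ... | i , ¬sᵢ≟αᵢ with i ∈? I | ¬sᵢ≟αᵢ
    ...   | yes i∈I | ¬sᵢ≟αᵢ′ = ⊥-elim (¬sᵢ≟αᵢ′ (fromWitness (agree i i∈I)))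
    ...   | no  _   | ¬sᵢ≟αᵢ′ = ⊥-elim (¬sᵢ≟αᵢ′ _)

allStates-complete : ∀ n (k : Fin n → ℕ) (s : State n k) →
                     ∃ λ t → t ∈ₗ allStates n k × (∀ i → t i ≡ s i)
allStates-complete zero    k s = (λ ()) , here refl , λ ()
allStates-complete (suc n) k s with allStates-complete n (k ∘ suc) (s ∘ suc)
... | t , t∈allStates , t≗s =
  _ , ∈-concatMap⁺ _ (lose (∈-allFin (s zero)) (∈-map⁺ _ t∈allStates)) ,
  λ { zero → refl ; (suc i) → t≗s i }

module _ {n : ℕ} {k : Fin n → ℕ} (I : Subset n) where

  fiber : IValue n k I → List (State n k)
  fiber α = filterᵇ (agreesᵇ I α) (allStates n k)

  ∈-fiber⁻ : ∀ {α t} → t ∈ₗ fiber α → ∀ i (i∈I : i ∈ I) → t i ≡ α i i∈I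
  ∈-fiber⁻ {α} {t} t∈fiber =
    to (agreesᵇ⇔ I α t) (proj₂ (∈-filter⁻ (T? ∘ agreesᵇ I α) {xs = allStates n k} t∈fiber))

  fiber-inhabited : ∀ s → ∃ (_∈ₗ fiber (restrict I s))
  fiber-inhabited s with allStates-complete n k s
  ... | t , t∈allStates , t≗s =
    t , ∈-filter⁺ (T? ∘ agreesᵇ I (restrict I s)) t∈allStates
                  (from (agreesᵇ⇔ I (restrict I s) t) (λ i _ → t≗s i))

  fiber-cong : ∀ {α β} → (∀ i (i∈I : i ∈ I) → α i i∈I ≡ β i i∈I) → fiber α ≡ fiber β
  fiber-cong {α} {β} α≗β =
    filter-≐ (T? ∘ agreesᵇ I α) (T? ∘ agreesᵇ I β) (α⊆β , β⊆α) (allStates n k)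
    where
    α⊆β : ∀ {t} → T (agreesᵇ I α t) → T (agreesᵇ I β t)
    α⊆β {t} agree = from (agreesᵇ⇔ I β t) λ i i∈I →
      trans (to (agreesᵇ⇔ I α t) agree i i∈I) (α≗β i i∈I)
    β⊆α : ∀ {t} → T (agreesᵇ I β t) → T (agreesᵇ I α t)
    β⊆α {t} agree = from (agreesᵇ⇔ I α t) λ i i∈I →
      trans (to (agreesᵇ⇔ I β t) agree i i∈I) (sym (α≗β i i∈I))

module _ {m n : ℕ} {k : Fin n → ℕ} (U : Fin m → State n k → ℚ) (P : State n k → ℚ) where

  weightedUtility : List (State n k) → Fin m → ℚ
  weightedUtility xs a = sumℚ (map (λ t → P t * U a t) xs)

  WeightedOpt : List (State n k) → Fin m → Set
  WeightedOpt xs c = ∀ b → weightedUtility xs b ≤ℚ weightedUtility xs c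

  module _ (I : Subset n) (α : IValue n k I) (P[α]>0 : 0ℚ <ℚ probEvent P I α) where

    condExp-≤⇔ : ∀ {a b} → condExp U P I α b ≤ℚ condExp U P I α a ⇔
                           weightedUtility (fiber I α) b ≤ℚ weightedUtility (fiber I α) a
    condExp-≤⇔ with probEvent P I α ℚ.≟ 0ℚ
    ... | yes P[α]≡0 = ⊥-elim (ℚ.<-irrefl (sym P[α]≡0) P[α]>0)
    ... | no  _      = ÷-monoˡ-≤⇔ (probEvent P I α) {{positive P[α]>0}}

    OptStoch⇔WeightedOpt : ∀ {c} → OptStoch U P I α c ⇔ WeightedOpt (fiber I α) c
    OptStoch⇔WeightedOpt =
      mk⇔ (λ opt b → to condExp-≤⇔ (opt b)) (λ opt b → from condExp-≤⇔ (opt b))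

  probEvent-pos : (∀ t → 0ℚ <ℚ P t) → ∀ I s → 0ℚ <ℚ probEvent P I (restrict I s)
  probEvent-pos P>0 I s =
    sumℚ-pos (fiber I (restrict I s)) (λ _ → P>0 _) (proj₂ (fiber-inhabited I s))

module _ {m n : ℕ} {k : Fin n → ℕ} (U : Fin (suc m) → State n k → ℚ) (P : State n k → ℚ)
         (P>0 : ∀ t → 0ℚ <ℚ P t) where

  WeightedOpt⇔Opt : ∀ {xs s c t₀} → t₀ ∈ₗ xs →
                    (∀ {t} → t ∈ₗ xs → SameSet (Opt U t) (Opt U s)) →
                    WeightedOpt U P xs c ⇔ Opt U s c
  WeightedOpt⇔Opt {xs} {s} {c} {t₀} t₀∈xs sameOpt = mk⇔ weighted⇒opt opt⇒weighted
    where
    a* = proj₁ (Opt-nonempty U s)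
    a*-opt = proj₂ (Opt-nonempty U s)

    opt⇒weighted : Opt U s c → WeightedOpt U P xs c
    opt⇒weighted c-opt b = sumℚ-mono-≤ xs λ {t} t∈xs →
      ℚ.*-monoˡ-≤-nonNeg (P t) {{ℚ.pos⇒nonNeg (P t) {{positive (P>0 t)}}}}
                         (from (sameOpt t∈xs c) c-opt b)

    weighted⇒opt : WeightedOpt U P xs c → Opt U s c
    weighted⇒opt c-wopt with U a* s ℚ.≤? U c s
    ... | yes a*≤c = from (Opt⇔≥-optimum U a*-opt) a*≤c
    ... | no  a*≰c = ⊥-elim (ℚ.<-irrefl refl (ℚ.<-≤-trans c<a*-weighted (c-wopt a*)))
      where
      -- If c were as good as a* at t, it would be optimal at t, hence at s.
      c<a* : ∀ {t} → t ∈ₗ xs → P t * U c t <ℚ P t * U a* t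
      c<a* {t} t∈xs = ℚ.*-monoʳ-<-pos (P t) {{positive (P>0 t)}} (ℚ.≰⇒> λ a*≤c →
        a*≰c (to (Opt⇔≥-optimum U a*-opt) (to (sameOpt t∈xs c)
          (from (Opt⇔≥-optimum U (from (sameOpt t∈xs a*) a*-opt)) a*≤c))))

      c<a*-weighted : weightedUtility U P xs c <ℚ weightedUtility U P xs a*
      c<a*-weighted = sumℚ-mono-< xs (ℚ.<⇒≤ ∘ c<a*) t₀∈xs (c<a* t₀∈xs)

  Sufficient⇒StochSufficient : ∀ I → Sufficient U I → StochSufficient U P I
  Sufficient⇒StochSufficient I sufficient s c =
    ⇔.trans (OptStoch⇔WeightedOpt U P I (restrict I s) (probEvent-pos U P P>0 I s))
            (WeightedOpt⇔Opt (proj₂ (fiber-inhabited I s))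
                             (λ t∈fiber → sufficient _ s (∈-fiber⁻ I t∈fiber)))

module _ {m n : ℕ} {k : Fin n → ℕ} (U : Fin m → State n k → ℚ) (P : State n k → ℚ)
         (P>0 : ∀ t → 0ℚ <ℚ P t) (I : Subset n) where

  StochSufficient⇒Sufficient : StochSufficient U P I → Sufficient U I
  StochSufficient⇒Sufficient stochSufficient s s′ sᵢ≡s′ᵢ c = begin
    Opt U s c                                       ≈⟨ stochSufficient s c ⟨
    OptStoch U P I (restrict I s) c                 ≈⟨ OptStoch⇔WeightedOpt U P I _ (probEvent-pos U P P>0 I s) ⟩
    WeightedOpt U P (fiber I (restrict I s)) c      ≡⟨ cong (λ xs → WeightedOpt U P xs c) (fiber-cong I sᵢ≡s′ᵢ) ⟩
    WeightedOpt U P (fiber I (restrict I s′)) c     ≈⟨ OptStoch⇔WeightedOpt U P I _ (probEvent-pos U P P>0 I s′) ⟨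
    OptStoch U P I (restrict I s′) c                ≈⟨ stochSufficient s′ c ⟩
    Opt U s′ c                                      ∎
    where open import Relation.Binary.Reasoning.Setoid (⇔.⇔-setoid 0ℓ)

mainTheorem3 : (m n : ℕ) (k : Fin n → ℕ)
               (U : Fin m → State n k → ℚ) (P : State n k → ℚ) →
               1 ≤ m → IsFullSupportDist P → (I : Subset n) →
               Sufficient U I ⇔ StochSufficient U P I
mainTheorem3 (suc m) n k U P _ (P>0 , _) I =
  mk⇔ (Sufficient⇒StochSufficient U P P>0 I) (StochSufficient⇒Sufficient U P P>0 I)
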